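{- Let $S$ be a modal semiring. (1) The only Noetherian test is $0$. (2) If $a+b$ is Noetherian then $a$ and $b$ are Noetherian. (3) If $b$ is Noetherian and $a\le b$, then $a$ is Noetherian. (4) If $S$ is a modal Kleene algebra, then $a\in S$ is Noetherian if and only if $a^+$ is Noetherian.
   Context: An idempotent semiring is a structure $(S,+,\cdot,0,1)$ such that $(S,+,0)$ is a commutative monoid with $a+a=a$, $(S,\cdot,1)$ is a monoid, multiplication distributes over addition from both sides, and $0a=a0=0$; natural order $a\le b\iff a+b=b$. A test is an element $p\le 1$ for which some $q$ satisfies $p+q=1$ and $pq=0=qp$; $q$ is unique, written $\neg p$; tests form a Boolean algebra $\mathrm{test}(S)$ (join $+$, meet $\cdot$); $p-q=p\cdot\neg q$. $S$ is a modal semiring if for each $a\in S$ there are maps $|a\rangle,\langle a|$ on $\mathrm{test}(S)$ with, for all $a,b,p,q$: $|a\rangle p\le q\iff \neg q\,a\,p\le 0$; $\langle a|p\le q\iff p\,a\,\neg q\le 0$; $|ab\rangle p=|a\rangle(|b\rangle p)$; $\langle ab|p=\langle b|(\langle a|p)$. An element $a$ is Noetherian if for all tests $p$, $p-|a\rangle p\le 0$ implies $p\le 0$. A Kleene algebra is an idempotent semiring with ${}^*$ such that $1+aa^*\le a^*$, $b+ac\le c\Rightarrow a^*b\le c$, $1+a^*a\le a^*$, $b+ca\le c\Rightarrow ba^*\le c$; $a^+=aa^*$; a modal Kleene algebra is a Kleene algebra that is a modal semiring. -}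

module Defs where

open import Level using (Level; _⊔_; suc)
open import Data.Product using (_×_)
open import Algebra.Bundles using (IdempotentSemiring)

module SemiringNotions {c ℓ : Level} (S : IdempotentSemiring c ℓ) where
  open IdempotentSemiring S

  infix 4 _≤_
  _≤_ : Carrier → Carrier → Set ℓ
  a ≤ b = (a + b) ≈ b

  record Test : Set (c ⊔ ℓ) where
    field
      elem   : Carrier
      neg    : Carrier
      elem≤1 : elem ≤ 1#
      join   : (elem + neg) ≈ 1#
      meetˡ  : (elem * neg) ≈ 0#
      meetʳ  : (neg * elem) ≈ 0#

  open Test public

  _-ₜ_ : Test → Test → Carrier
  p -ₜ q = elem p * neg q

  record IsModal (fdia bdia : Carrier → Test → Test) : Set (c ⊔ ℓ) where
    field
      fdia-adj  : ∀ a p q → (elem (fdia a p) ≤ elem q → ((neg q * a) * elem p) ≤ 0#)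
                          × (((neg q * a) * elem p) ≤ 0# → elem (fdia a p) ≤ elem q)
      bdia-adj  : ∀ a p q → (elem (bdia a p) ≤ elem q → ((elem p * a) * neg q) ≤ 0#)
                          × (((elem p * a) * neg q) ≤ 0# → elem (bdia a p) ≤ elem q)
      fdia-comp : ∀ a b p → elem (fdia (a * b) p) ≈ elem (fdia a (fdia b p))
      bdia-comp : ∀ a b p → elem (bdia (a * b) p) ≈ elem (bdia b (bdia a p))

record ModalSemiring (c ℓ : Level) : Set (suc (c ⊔ ℓ)) where
  field
    idemSemiring : IdempotentSemiring c ℓ
  open IdempotentSemiring idemSemiring public
  open SemiringNotions idemSemiring public
  field
    fdia    : Carrier → Test → Test
    bdia    : Carrier → Test → Test
    isModal : IsModal fdia bdia

  Noetherian : Carrier → Set (c ⊔ ℓ)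
  Noetherian a = ∀ (p : Test) → (p -ₜ fdia a p) ≤ 0# → elem p ≤ 0#


record ModalKleeneAlgebra (c ℓ : Level) : Set (suc (c ⊔ ℓ)) where
  field
    modalSemiring : ModalSemiring c ℓ
  open ModalSemiring modalSemiring public
  field
    _⋆ : Carrier → Carrier
    star-unfoldˡ : ∀ a → (1# + (a * (a ⋆))) ≤ (a ⋆)
    star-indˡ    : ∀ a b x → (b + (a * x)) ≤ x → ((a ⋆) * b) ≤ x
    star-unfoldʳ : ∀ a → (1# + ((a ⋆) * a)) ≤ (a ⋆)
    star-indʳ    : ∀ a b x → (b + (x * a)) ≤ x → (b * (a ⋆)) ≤ x

  _⁺ : Carrier → Carrier
  a ⁺ = a * (a ⋆)

module Submission where

-- The whole argument runs through one notion: x is GUARDED by a test p when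
-- ¬p · x ≤ 0, i.e. x ≈ p · x ("every run of x starts in p").  The forward
-- diamond is then characterised by two facts: |a⟩p is the least test guarding
-- a · p, and guards are transported along a (if p guards x then |a⟩p guards
-- a · x).  For tests p, s being guarded is just p ≤ s, so a is Noetherian iff
-- every test p with p ≤ |a⟩p is 0.
--
-- Parts (1)-(3)
-- follow from monotonicity of |a⟩ in a together with |0⟩p ≤ 0 and p ≤ |p⟩p.
-- For (4) the nontrivial direction takes p ≤ |a⁺⟩p = |a⟩q with q = |a⋆⟩p;
-- the test |a⟩q guards p and a · a⋆ · p, hence also a⋆ · p ≤ p + a · a⋆ · p,
-- so q ≤ |a⟩q; Noetherianity of a gives q ≤ 0, whence p ≤ q ≤ 0.

open import Defs
open import Level using (Level)
open import Data.Product using (_×_; _,_; proj₁; proj₂)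
open import Function.Bundles using (_⇔_; mk⇔)
open import Algebra.Bundles using (IdempotentSemiring)
open import Relation.Binary.Bundles using (Poset)
open import Relation.Binary.Structures using (IsPartialOrder)

module NaturalOrder {c ℓ : Level} (S : IdempotentSemiring c ℓ) where
  open IdempotentSemiring S
  open SemiringNotions S

  ≤-isPartialOrder : IsPartialOrder _≈_ _≤_
  ≤-isPartialOrder = record
    { isPreorder = record
      { isEquivalence = isEquivalence
      ; reflexive     = λ {a} {b} a≈b → trans (+-congʳ a≈b) (+-idem b)
      ; trans         = λ {a} {b} {d} a≤b b≤d →
          trans (+-congˡ (sym b≤d))
          (trans (sym (+-assoc a b d)) (trans (+-congʳ a≤b) b≤d))
      }
    ; antisym = λ {a} {b} a≤b b≤a →
        trans (sym b≤a) (trans (+-comm b a) a≤b)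
    }

  ≤-poset : Poset c ℓ ℓ
  ≤-poset = record { isPartialOrder = ≤-isPartialOrder }

  open Poset ≤-poset public
    using (antisym) renaming (refl to ≤-refl; reflexive to ≤-reflexive; trans to ≤-trans)

  +-upperˡ : ∀ x y → x ≤ x + y
  +-upperˡ x y = trans (sym (+-assoc x x y)) (+-congʳ (+-idem x))

  +-upperʳ : ∀ x y → y ≤ x + y
  +-upperʳ x y = ≤-trans (+-upperˡ y x) (≤-reflexive (+-comm y x))

  +-lub : ∀ {x y z} → x ≤ z → y ≤ z → x + y ≤ z
  +-lub {x} {y} {z} x≤z y≤z = trans (+-assoc x y z) (trans (+-congˡ y≤z) x≤z)

  0-least : ∀ x → 0# ≤ x
  0-least = +-identityˡ

  ≤0⇒≈0 : ∀ {x} → x ≤ 0# → x ≈ 0#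
  ≤0⇒≈0 x≤0 = antisym x≤0 (0-least _)

  *-monoˡ-≤ : ∀ x {a b} → a ≤ b → x * a ≤ x * b
  *-monoˡ-≤ x {a} {b} a≤b = trans (sym (distribˡ x a b)) (*-congˡ a≤b)

  *-monoʳ-≤ : ∀ x {a b} → a ≤ b → a * x ≤ b * x
  *-monoʳ-≤ x {a} {b} a≤b = trans (sym (distribʳ x a b)) (*-congʳ a≤b)

module TestCalculus {c ℓ : Level} (S : IdempotentSemiring c ℓ) where
  open IdempotentSemiring S
  open SemiringNotions S
  open NaturalOrder S
  open import Relation.Binary.Reasoning.PartialOrder ≤-poset

  -- x is guarded by the test p: ¬p · x ≤ 0.  (A record, so that p can be
  -- inferred from a proof of GuardedBy p x.)
  record GuardedBy (p : Test) (x : Carrier) : Set ℓ where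
    constructor guarded
    field unguarded≤0 : neg p * x ≤ 0#

  zeroTest : Test
  zeroTest = record
    { elem = 0# ; neg = 1# ; elem≤1 = +-identityˡ 1#
    ; join = +-identityˡ 1# ; meetˡ = zeroˡ 1# ; meetʳ = zeroʳ 1# }

  guarded-absorb : ∀ {p x} → GuardedBy p x → x ≈ elem p * x
  guarded-absorb {p} {x} (guarded g) = begin-equality
    x                          ≈⟨ *-identityˡ x ⟨
    1# * x                     ≈⟨ *-congʳ (join p) ⟨
    (elem p + neg p) * x       ≈⟨ distribʳ x (elem p) (neg p) ⟩
    elem p * x + neg p * x     ≈⟨ +-congˡ (≤0⇒≈0 g) ⟩
    elem p * x + 0#            ≈⟨ +-identityʳ _ ⟩
    elem p * x                 ∎

  guarded-≤ : ∀ {p x y} → x ≤ y → GuardedBy p y → GuardedBy p x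
  guarded-≤ {p} x≤y (guarded g) = guarded (≤-trans (*-monoˡ-≤ (neg p) x≤y) g)

  guarded-+ : ∀ {p x y} → GuardedBy p x → GuardedBy p y → GuardedBy p (x + y)
  guarded-+ {p} {x} {y} (guarded gx) (guarded gy) = guarded (begin
    neg p * (x + y)          ≈⟨ distribˡ (neg p) x y ⟩
    neg p * x + neg p * y    ≤⟨ +-lub gx gy ⟩
    0#                       ∎)

  guarded-self : ∀ p → GuardedBy p (elem p)
  guarded-self p = guarded (≤-reflexive (meetʳ p))

  test-idem : ∀ p → elem p * elem p ≈ elem p
  test-idem p = sym (guarded-absorb (guarded-self p))

  test-≤⇒guarded : ∀ p s → elem p ≤ elem s → GuardedBy s (elem p)
  test-≤⇒guarded p s p≤s = guarded-≤ p≤s (guarded-self s)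

  guarded⇒test-≤ : ∀ p s → GuardedBy s (elem p) → elem p ≤ elem s
  guarded⇒test-≤ p s g = begin
    elem p           ≈⟨ guarded-absorb g ⟩
    elem s * elem p  ≤⟨ *-monoˡ-≤ (elem s) (elem≤1 p) ⟩
    elem s * 1#      ≈⟨ *-identityʳ (elem s) ⟩
    elem s           ∎

  test-≤⇒diff≤0 : ∀ p s → elem p ≤ elem s → p -ₜ s ≤ 0#
  test-≤⇒diff≤0 p s p≤s = begin
    elem p * neg s  ≤⟨ *-monoʳ-≤ (neg s) p≤s ⟩
    elem s * neg s  ≈⟨ meetˡ s ⟩
    0#              ∎

  diff≤0⇒test-≤ : ∀ p s → p -ₜ s ≤ 0# → elem p ≤ elem s
  diff≤0⇒test-≤ p s d = begin
    elem p                         ≈⟨ *-identityʳ (elem p) ⟨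
    elem p * 1#                    ≈⟨ *-congˡ (join s) ⟨
    elem p * (elem s + neg s)      ≈⟨ distribˡ (elem p) (elem s) (neg s) ⟩
    elem p * elem s + p -ₜ s       ≈⟨ +-congˡ (≤0⇒≈0 d) ⟩
    elem p * elem s + 0#           ≈⟨ +-identityʳ _ ⟩
    elem p * elem s                ≤⟨ *-monoʳ-≤ (elem s) (elem≤1 p) ⟩
    1# * elem s                    ≈⟨ *-identityˡ (elem s) ⟩
    elem s                         ∎

module Noetherianity {c ℓ : Level} (S : ModalSemiring c ℓ) where
  open ModalSemiring S
  open IsModal isModal
  open NaturalOrder idemSemiring
  open TestCalculus idemSemiring
  open import Relation.Binary.Reasoning.PartialOrder ≤-poset

  fdia-least : ∀ a p q → GuardedBy q (a * elem p) → elem (fdia a p) ≤ elem q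
  fdia-least a p q (guarded g) = proj₂ (fdia-adj a p q) (begin
    (neg q * a) * elem p  ≈⟨ *-assoc (neg q) a (elem p) ⟩
    neg q * (a * elem p)  ≤⟨ g ⟩
    0#                    ∎)

  fdia-guarded : ∀ a {p x} → GuardedBy p x → GuardedBy (fdia a p) (a * x)
  fdia-guarded a {p} {x} g = guarded (begin
    neg r * (a * x)                 ≈⟨ *-congˡ (*-congˡ (guarded-absorb g)) ⟩
    neg r * (a * (elem p * x))      ≈⟨ *-congˡ (*-assoc a (elem p) x) ⟨
    neg r * ((a * elem p) * x)      ≈⟨ *-assoc (neg r) (a * elem p) x ⟨
    (neg r * (a * elem p)) * x      ≈⟨ *-congʳ (*-assoc (neg r) a (elem p)) ⟨
    ((neg r * a) * elem p) * x      ≤⟨ *-monoʳ-≤ x unit ⟩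
    0# * x                          ≈⟨ zeroˡ x ⟩
    0#                              ∎)
    where
    r : Test
    r = fdia a p
    unit : (neg r * a) * elem p ≤ 0#
    unit = proj₁ (fdia-adj a p r) ≤-refl

  fdia-mono : ∀ {a b} p → a ≤ b → elem (fdia a p) ≤ elem (fdia b p)
  fdia-mono {a} {b} p a≤b = fdia-least a p (fdia b p)
    (guarded-≤ (*-monoʳ-≤ (elem p) a≤b) (fdia-guarded b (guarded-self p)))

  fdia-zero : ∀ p → elem (fdia 0# p) ≤ 0#
  fdia-zero p = fdia-least 0# p zeroTest (guarded (begin
    1# * (0# * elem p)  ≈⟨ *-identityˡ _ ⟩
    0# * elem p         ≈⟨ zeroˡ (elem p) ⟩
    0#                  ∎))

  fdia-test-≥ : ∀ p → elem p ≤ elem (fdia (elem p) p)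
  fdia-test-≥ p = guarded⇒test-≤ p (fdia (elem p) p)
    (guarded-≤ (≤-reflexive (sym (test-idem p))) (fdia-guarded (elem p) (guarded-self p)))

  noetherian-intro : ∀ {a} → (∀ p → elem p ≤ elem (fdia a p) → elem p ≤ 0#) → Noetherian a
  noetherian-intro N p d = N p (diff≤0⇒test-≤ p (fdia _ p) d)

  noetherian-elim : ∀ {a} → Noetherian a → ∀ p → elem p ≤ elem (fdia a p) → elem p ≤ 0#
  noetherian-elim N p p≤ = N p (test-≤⇒diff≤0 p (fdia _ p) p≤)

  noetherian-≤ : ∀ a b → Noetherian b → a ≤ b → Noetherian a
  noetherian-≤ a b N a≤b = noetherian-intro λ p p≤ →
    noetherian-elim N p (≤-trans p≤ (fdia-mono p a≤b))

  noetherian-+ : ∀ a b → Noetherian (a + b) → Noetherian a × Noetherian b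
  noetherian-+ a b N = noetherian-≤ a (a + b) N (+-upperˡ a b)
                     , noetherian-≤ b (a + b) N (+-upperʳ a b)

  noetherian-zero : Noetherian 0#
  noetherian-zero = noetherian-intro λ p p≤ → ≤-trans p≤ (fdia-zero p)

  noetherian-test : ∀ p → Noetherian (elem p) ⇔ (elem p ≈ 0#)
  noetherian-test p = mk⇔
    (λ N → ≤0⇒≈0 (noetherian-elim N p (fdia-test-≥ p)))
    (λ p≈0 → noetherian-≤ (elem p) 0# noetherian-zero (≤-reflexive p≈0))

module PlusNoetherianity {c ℓ : Level} (K : ModalKleeneAlgebra c ℓ) where
  open ModalKleeneAlgebra K
  open IsModal isModal
  open NaturalOrder idemSemiring
  open TestCalculus idemSemiring
  open Noetherianity modalSemiring
  open import Relation.Binary.Reasoning.PartialOrder ≤-poset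

  1≤⋆ : ∀ a → 1# ≤ a ⋆
  1≤⋆ a = ≤-trans (+-upperˡ 1# (a * a ⋆)) (star-unfoldˡ a)

  ≤-⋆* : ∀ a x → x ≤ a ⋆ * x
  ≤-⋆* a x = begin
    x         ≈⟨ *-identityˡ x ⟨
    1# * x    ≤⟨ *-monoʳ-≤ x (1≤⋆ a) ⟩
    a ⋆ * x   ∎

  ≤-⁺ : ∀ a → a ≤ a ⁺
  ≤-⁺ a = begin
    a          ≈⟨ *-identityʳ a ⟨
    a * 1#     ≤⟨ *-monoˡ-≤ a (1≤⋆ a) ⟩
    a * a ⋆    ∎

  -- The converse unfolding inequality a⋆ ≤ 1 + a · a⋆: by star induction,
  -- since u = 1 + a · a⋆ satisfies 1 + a · u ≤ u.
  ⋆-unfold-≤ : ∀ a → a ⋆ ≤ 1# + a * a ⋆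
  ⋆-unfold-≤ a = begin
    a ⋆         ≈⟨ *-identityʳ (a ⋆) ⟨
    a ⋆ * 1#    ≤⟨ star-indˡ a 1# u u-closed ⟩
    u           ∎
    where
    u : Carrier
    u = 1# + a * a ⋆
    a·u≤a⁺ : a * u ≤ a * a ⋆
    a·u≤a⁺ = begin
      a * u                   ≈⟨ distribˡ a 1# (a * a ⋆) ⟩
      a * 1# + a * (a * a ⋆)  ≤⟨ +-lub (≤-trans (≤-reflexive (*-identityʳ a)) (≤-⁺ a))
                                       (*-monoˡ-≤ a (≤-trans (+-upperʳ 1# (a * a ⋆)) (star-unfoldˡ a))) ⟩
      a * a ⋆                 ∎
    u-closed : 1# + a * u ≤ u
    u-closed = +-lub (+-upperˡ 1# (a * a ⋆)) (≤-trans a·u≤a⁺ (+-upperʳ 1# (a * a ⋆)))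

  ⋆*-unfold-≤ : ∀ a x → a ⋆ * x ≤ x + a * (a ⋆ * x)
  ⋆*-unfold-≤ a x = begin
    a ⋆ * x                    ≤⟨ *-monoʳ-≤ x (⋆-unfold-≤ a) ⟩
    (1# + a * a ⋆) * x         ≈⟨ distribʳ x 1# (a * a ⋆) ⟩
    1# * x + (a * a ⋆) * x     ≈⟨ +-cong (*-identityˡ x) (*-assoc a (a ⋆) x) ⟩
    x + a * (a ⋆ * x)          ∎

  -- If a is Noetherian, so is a⁺.  Given p ≤ |a⁺⟩p = |a⟩q with q = |a⋆⟩p,
  -- the test r = |a⟩q guards p and a · a⋆ · p, hence a⋆ · p; so q ≤ r,
  -- i.e. q ≤ |a⟩q, which forces q ≤ 0, and p ≤ q.
  noetherian-⁺ : ∀ a → Noetherian a → Noetherian (a ⁺)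
  noetherian-⁺ a N = noetherian-intro p≤0
    where
    p≤0 : ∀ p → elem p ≤ elem (fdia (a ⁺) p) → elem p ≤ 0#
    p≤0 p p≤ = ≤-trans p≤q q≤0
      where
      q r : Test
      q = fdia (a ⋆) p
      r = fdia a q
      q-guards : GuardedBy q (a ⋆ * elem p)
      q-guards = fdia-guarded (a ⋆) (guarded-self p)
      p≤r : elem p ≤ elem r
      p≤r = ≤-trans p≤ (≤-reflexive (fdia-comp a (a ⋆) p))
      r-guards : GuardedBy r (a ⋆ * elem p)
      r-guards = guarded-≤ (⋆*-unfold-≤ a (elem p))
                   (guarded-+ (test-≤⇒guarded p r p≤r) (fdia-guarded a q-guards))
      q≤0 : elem q ≤ 0#
      q≤0 = noetherian-elim N q (fdia-least (a ⋆) p r r-guards)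
      p≤q : elem p ≤ elem q
      p≤q = guarded⇒test-≤ p q (guarded-≤ (≤-⋆* a (elem p)) q-guards)

  noetherian⇔noetherian-⁺ : ∀ a → Noetherian a ⇔ Noetherian (a ⁺)
  noetherian⇔noetherian-⁺ a = mk⇔ (noetherian-⁺ a) (λ N → noetherian-≤ a (a ⁺) N (≤-⁺ a))

lemma4p6 : ∀ {c ℓ : Level}
    → ((S : ModalSemiring c ℓ) → let open ModalSemiring S in
        (∀ (p : Test) → Noetherian (elem p) ⇔ (elem p ≈ 0#))
        × (∀ a b → Noetherian (a + b) → Noetherian a × Noetherian b)
        × (∀ a b → Noetherian b → a ≤ b → Noetherian a))
    × ((K : ModalKleeneAlgebra c ℓ) → let open ModalKleeneAlgebra K in
        ∀ a → Noetherian a ⇔ Noetherian (a ⁺))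
lemma4p6 =
  (λ S → let open Noetherianity S in noetherian-test , noetherian-+ , noetherian-≤)
  , PlusNoetherianity.noetherian⇔noetherian-⁺
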